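{- Let $k\geq 2$ and $n\equiv 1\pmod{4k}$. Suppose that the set $[1,(n-1)/2]$ partitions into sets $D_1,\dots,D_{(n-1)/(2k)}$, each of which is balanced and of size $2k$. Then the cycles $C(D_i)$, $i\in[1,(n-1)/(2k)]$ (with vertices read in $\mathbb{Z}_n$), form a set of starter cycles for a cyclic $2k$-cycle decomposition of $K_n$; that is, $\{C(D_i)+j \mid i\in[1,(n-1)/(2k)],\ j\in[0,n-1]\}$ is a cyclic decomposition of $K_n$ into $2k$-cycles.
   Context: $[a,b]$ denotes $\{a,a+1,\dots,b\}$. $K_n$ has vertex set $\mathbb{Z}_n$; for a cycle $C=(c_0,\dots,c_{m-1})$ and $g\in\mathbb{Z}_n$, $C+g=(c_0+g,\dots,c_{m-1}+g)$. If $D=\{d_1,\dots,d_{2k}\}$ is a set of positive integers with $d_1<d_2<\dots<d_{2k}$, its alternating difference pattern is $(s_1,\dots,s_k)$ with $s_i=d_{2i}-d_{2i-1}$, and $D$ is balanced if there is $\tau\in[1,k]$ with $\sum_{i=1}^{\tau}s_i=\sum_{i=\tau+1}^k s_i$. For balanced $D$ (with such a $\tau$), define $\delta_i=d_i$ for $1\le i\le 2\tau-1$, $\delta_i=d_{i+1}$ for $2\tau\le i\le 2k-1$, $\delta_{2k}=d_{2\tau}$; set $c_0=0$ and $c_i=\sum_{h=1}^i(-1)^h\delta_h$ for $1\le i\le 2k-1$, and $C(D)=(c_0,c_1,\dots,c_{2k-1})$. A cyclic $2k$-cycle decomposition of $K_n$ is a partition of its edges into $2k$-cycles closed under all translations $C\mapsto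 C+g$. -}

module Defs where

open import Data.Nat as ℕ using (ℕ; zero; suc; _+_; _*_; _∸_; _≤_; _<_)
open import Data.Integer as ℤ using (ℤ; +_; _%ℕ_)
open import Data.Bool using (Bool; true; false)
open import Data.List using (List; []; _∷_; _++_; take; drop; length; zip; map; [_])
open import Data.Nat.ListAction using (sum)
open import Data.List.Membership.Propositional using (_∈_)
open import Data.List.Relation.Unary.Linked using (Linked)
open import Data.List.Relation.Unary.Unique.Propositional using (Unique)
open import Data.List.Relation.Unary.All using (All)
open import Data.Product using (_×_; ∃; ∃-syntax; _,_)
open import Data.Sum using (_⊎_)
open import Relation.Binary.PropositionalEquality using (_≡_; _≢_)

-- Sets of positive integers D = {d₁ < … < d₂ₖ} are represented by the
-- strictly increasing list [d₁, …, d₂ₖ].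

StrictlyIncreasing : List ℕ → Set
StrictlyIncreasing = Linked _<_

altPattern : List ℕ → List ℕ
altPattern (a ∷ b ∷ r) = (b ∸ a) ∷ altPattern r
altPattern _           = []

BalancedWith : ℕ → List ℕ → Set
BalancedWith τ D =
  1 ≤ τ × τ ≤ length (altPattern D) ×
  sum (take τ (altPattern D)) ≡ sum (drop τ (altPattern D))

Balanced : List ℕ → Set
Balanced D = ∃[ τ ] BalancedWith τ D

-- (δ₁,…,δ₂ₖ) = (d₁,…,d_{2τ−1}, d_{2τ+1},…,d₂ₖ, d_{2τ})
deltas : ℕ → List ℕ → List ℕ
deltas τ D = take (2 * τ ∸ 1) D ++ drop (2 * τ) D ++ take 1 (drop (2 * τ ∸ 1) D)

-- partial alternating sums; the Bool says whether the next term is subtracted.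
-- partials 0 true (δ₁ ∷ … ∷ δ₂ₖ) = [c₀, c₁, …, c₂ₖ₋₁]
partials : ℤ → Bool → List ℕ → List ℤ
partials acc _     []       = []
partials acc true  (d ∷ ds) = acc ∷ partials (acc ℤ.- + d) false ds
partials acc false (d ∷ ds) = acc ∷ partials (acc ℤ.+ + d) true ds

cycleC : ℕ → List ℕ → List ℤ
cycleC τ D = partials (+ 0) true (deltas τ D)

-- Z_n : vertices are the residues 0,…,n−1 (as naturals)

toZn : ℕ → ℤ → ℕ
toZn zero    z = 0
toZn (suc n) z = z %ℕ suc n

translateZn : ℕ → List ℤ → ℕ → List ℕ
translateZn n C j = map (λ c → toZn n (c ℤ.+ + j)) C

shiftZn : ℕ → ℕ → List ℕ → List ℕ
shiftZn n g C = map (λ v → toZn n (+ (v + g))) C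

cycleEdges : List ℕ → List (ℕ × ℕ)
cycleEdges []       = []
cycleEdges (v ∷ vs) = zip (v ∷ vs) (vs ++ [ v ])

HasEdge : List ℕ → ℕ → ℕ → Set
HasEdge C x y = ((x , y) ∈ cycleEdges C) ⊎ ((y , x) ∈ cycleEdges C)

IsCycleIn : ℕ → ℕ → List ℕ → Set
IsCycleIn n L C = length C ≡ L × Unique C × All (_< n) C

module Submission where

-- Write n = 2M + 1.  Along the alternating walk C(D) the even-indexed vertices increase within [0, M] and
-- the odd-indexed ones decrease within [-M, 0), so its 2k vertices are distinct integers of absolute value
-- at most M; balance is exactly the condition for the walk to close, and its edge lengths are then the
-- elements of D, each once.  Reduction mod n is injective on [-M, M], so every translate is a 2k-cycle.
-- An edge {x, y} of K_n determines the unique length e ∈ [1, M] with y - x ≡ ±e; e lies in exactly one D_i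
-- and on exactly one edge {u, v} of C(D_i), and then the translation j ≡ x - u is forced.

open import Defs
open import Data.Bool using (Bool; true; false)
open import Data.Fin using (Fin; toℕ; fromℕ<)
import Data.Fin.Properties as FinP
open import Data.Integer as ℤ using (ℤ; +_; -[1+_]; ∣_∣; _%ℕ_; _/ℕ_)
import Data.Integer.Properties as ℤP
open import Data.Integer.DivMod using (a≡a%ℕn+[a/ℕn]*n; n%ℕd<d)
open import Data.Integer.Divisibility.Signed using (_∣_; divides; ∣m∣n⇒∣m+n; ∣m⇒∣-m; ∣⇒∣ᵤ)
open import Data.Integer.Tactic.RingSolver using (solve-∀)
open import Data.List using (List; []; _∷_; _++_; [_]; zip; map; length; take; drop)
import Data.List.Properties as LP
open import Data.List.Membership.Propositional using (_∈_)
import Data.List.Membership.Propositional.Properties as ∈P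
open import Data.List.Relation.Binary.Permutation.Propositional using (_↭_; prep; ↭-sym; ↭⇒↭ₛ)
import Data.List.Relation.Binary.Permutation.Propositional.Properties as ↭P
import Data.List.Relation.Binary.Permutation.Setoid.Properties as ↭ₛP
open import Data.List.Relation.Unary.All as All using (All; []; _∷_)
import Data.List.Relation.Unary.All.Properties as AllP
open import Data.List.Relation.Unary.AllPairs as AllPairs using ([]; _∷_)
open import Data.List.Relation.Unary.Any using (here; there)
open import Data.List.Relation.Unary.Linked using ([-]; _∷_)
import Data.List.Relation.Unary.Linked.Properties as LinkedP
open import Data.List.Relation.Unary.Unique.Propositional using (Unique)
open import Data.Nat as ℕ using (ℕ; zero; suc; NonZero; z≤n; s≤s; _∸_; _/_)
open import Data.Nat.DivMod using (m<n⇒m%n≡m; m*n/n≡m)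
import Data.Nat.Divisibility as ℕ∣
open import Data.Nat.ListAction using (sum)
import Data.Nat.ListAction.Properties as ΣP
import Data.Nat.Properties as ℕP
open import Data.Nat.Tactic.RingSolver using () renaming (solve-∀ to solveℕ-∀)
open import Data.Product as Product using (_×_; _,_; proj₁; proj₂; uncurry; ∃; ∃₂; ∃!; ∃-syntax)
open import Data.Product.Properties using (,-injective)
open import Data.Sum using (_⊎_; inj₁; inj₂)
open import Relation.Binary.Bundles using (Setoid)
import Relation.Binary.Reasoning.Setoid as SetoidReasoning
open import Relation.Binary.PropositionalEquality as ≡
  using (_≡_; _≢_; ≢-sym; refl; sym; trans; cong; cong₂; subst; subst₂; module ≡-Reasoning)
open import Relation.Nullary using (yes; no; contradiction)

-- Integer arithmetic is opened only inside this module, so that _+_, _*_, _≤_, _<_ mean the ℕ operations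
-- in the statement of corollary8.
module _ where
  open import Data.Integer using (_+_; _-_; -_; _*_; _≤_; _<_)

  -- A record rather than a definition, so that a and b can be inferred from a proof's type.
  infix 4 _≡_⟨mod_⟩
  record _≡_⟨mod_⟩ (a b : ℤ) (n : ℕ) : Set where
    constructor ≡mod
    field n∣a-b : + n ∣ a - b
  open _≡_⟨mod_⟩

  module _ {n : ℕ} where

    ≡mod-reflexive : ∀ {a b} → a ≡ b → a ≡ b ⟨mod n ⟩
    ≡mod-reflexive {a} refl = ≡mod (divides (+ 0) (a-a≡0*n a (+ n)))
      where a-a≡0*n : ∀ a n → a - a ≡ + 0 * n
            a-a≡0*n = solve-∀

    ≡mod-sym : ∀ {a b} → a ≡ b ⟨mod n ⟩ → b ≡ a ⟨mod n ⟩
    ≡mod-sym {a} {b} p = ≡mod (subst (+ n ∣_) (-[a-b]≡b-a a b) (∣m⇒∣-m (n∣a-b p)))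
      where -[a-b]≡b-a : ∀ a b → - (a - b) ≡ b - a
            -[a-b]≡b-a = solve-∀

    ≡mod-trans : ∀ {a b c} → a ≡ b ⟨mod n ⟩ → b ≡ c ⟨mod n ⟩ → a ≡ c ⟨mod n ⟩
    ≡mod-trans {a} {b} {c} p q = ≡mod (subst (+ n ∣_) (telescope a b c) (∣m∣n⇒∣m+n (n∣a-b p) (n∣a-b q)))
      where telescope : ∀ a b c → (a - b) + (b - c) ≡ a - c
            telescope = solve-∀

    +-cong-mod : ∀ {a b c d} → a ≡ b ⟨mod n ⟩ → c ≡ d ⟨mod n ⟩ → a + c ≡ b + d ⟨mod n ⟩
    +-cong-mod {a} {b} {c} {d} p q = ≡mod (subst (+ n ∣_) (interchange a b c d) (∣m∣n⇒∣m+n (n∣a-b p) (n∣a-b q)))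
      where interchange : ∀ a b c d → (a - b) + (c - d) ≡ (a + c) - (b + d)
            interchange = solve-∀

    +-congˡ-mod : ∀ c {a b} → a ≡ b ⟨mod n ⟩ → c + a ≡ c + b ⟨mod n ⟩
    +-congˡ-mod c = +-cong-mod (≡mod-reflexive {a = c} refl)

    +-congʳ-mod : ∀ c {a b} → a ≡ b ⟨mod n ⟩ → a + c ≡ b + c ⟨mod n ⟩
    +-congʳ-mod c p = +-cong-mod p (≡mod-reflexive {a = c} refl)

    neg-cong-mod : ∀ {a b} → a ≡ b ⟨mod n ⟩ → - a ≡ - b ⟨mod n ⟩
    neg-cong-mod {a} {b} p = ≡mod (subst (+ n ∣_) (-[a-b]≡-a--b a b) (∣m⇒∣-m (n∣a-b p)))
      where -[a-b]≡-a--b : ∀ a b → - (a - b) ≡ - a - - b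
            -[a-b]≡-a--b = solve-∀

    -‿cong-mod : ∀ {a b c d} → a ≡ b ⟨mod n ⟩ → c ≡ d ⟨mod n ⟩ → a - c ≡ b - d ⟨mod n ⟩
    -‿cong-mod p q = +-cong-mod p (neg-cong-mod q)

    n≡0-mod : + n ≡ + 0 ⟨mod n ⟩
    n≡0-mod = ≡mod (divides (+ 1) (n-0≡1*n (+ n)))
      where n-0≡1*n : ∀ n → n - + 0 ≡ + 1 * n
            n-0≡1*n = solve-∀

    +-cancelʳ-mod : ∀ {a b} c → a + c ≡ b + c ⟨mod n ⟩ → a ≡ b ⟨mod n ⟩
    +-cancelʳ-mod {a} {b} c p = ≡mod-trans (≡mod-reflexive (sym ([i+c]-c≡i a c)))
      (≡mod-trans (+-congʳ-mod (- c) p) (≡mod-reflexive ([i+c]-c≡i b c)))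
      where [i+c]-c≡i : ∀ i c → (i + c) - c ≡ i
            [i+c]-c≡i = solve-∀

    +-cancelˡ-mod : ∀ {a b} c → c + a ≡ c + b ⟨mod n ⟩ → a ≡ b ⟨mod n ⟩
    +-cancelˡ-mod {a} {b} c p = +-cancelʳ-mod c (≡mod-trans (≡mod-reflexive (ℤP.+-comm a c))
      (≡mod-trans p (≡mod-reflexive (ℤP.+-comm c b))))

    ≡mod-setoid : Setoid _ _
    ≡mod-setoid = record
      { Carrier = ℤ
      ; _≈_ = _≡_⟨mod n ⟩
      ; isEquivalence = record { refl = ≡mod-reflexive refl ; sym = ≡mod-sym ; trans = ≡mod-trans }
      }

    ≡mod∧small⇒≡ : ∀ {a b} → a ≡ b ⟨mod n ⟩ → ∣ a - b ∣ ℕ.< n → a ≡ b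
    ≡mod∧small⇒≡ {a} {b} p lt with ∣ a - b ∣ in eq
    ... | zero  = ℤP.i-j≡0⇒i≡j a b (ℤP.∣i∣≡0⇒i≡0 eq)
    ... | suc _ = contradiction (subst (n ℕ∣.∣_) eq (∣⇒∣ᵤ (n∣a-b p))) (ℕ∣.>⇒∤ lt)

    ∣[+m]-[+k]∣< : ∀ {m k} → m ℕ.< n → k ℕ.< n → ∣ + m - + k ∣ ℕ.< n
    ∣[+m]-[+k]∣< {m} {k} m<n k<n = subst (ℕ._< n) (cong ∣_∣ (sym (ℤP.[+m]-[+n]≡m⊖n m k)))
      (ℕP.≤-trans (s≤s (ℤP.∣m⊝n∣≤m⊔n m k)) (ℕP.⊔-lub m<n k<n))

    +-injective-mod : ∀ {m k} → + m ≡ + k ⟨mod n ⟩ → m ℕ.< n → k ℕ.< n → m ≡ k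
    +-injective-mod p m<n k<n = ℤP.+-injective (≡mod∧small⇒≡ p (∣[+m]-[+k]∣< m<n k<n))

    module _ .{{_ : NonZero n}} where

      %ℕ-≡mod : ∀ a → + (a %ℕ n) ≡ a ⟨mod n ⟩
      %ℕ-≡mod a = ≡mod (divides (- (a /ℕ n)) (begin
        + (a %ℕ n) - a                          ≡⟨ cong (λ x → + (a %ℕ n) - x) (a≡a%ℕn+[a/ℕn]*n a n) ⟩
        + (a %ℕ n) - (+ (a %ℕ n) + a /ℕ n * + n) ≡⟨ r-[r+q*n]≡-q*n (+ (a %ℕ n)) (a /ℕ n) (+ n) ⟩
        - (a /ℕ n) * + n                        ∎))
        where
        open ≡-Reasoning
        r-[r+q*n]≡-q*n : ∀ r q n → r - (r + q * n) ≡ - q * n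
        r-[r+q*n]≡-q*n = solve-∀

      ≡mod⇒%ℕ≡ : ∀ {a b} → a ≡ b ⟨mod n ⟩ → a %ℕ n ≡ b %ℕ n
      ≡mod⇒%ℕ≡ {a} {b} p = +-injective-mod (≡mod-trans (%ℕ-≡mod a) (≡mod-trans p (≡mod-sym (%ℕ-≡mod b))))
        (n%ℕd<d a n) (n%ℕd<d b n)

      %ℕ≡⇒≡mod : ∀ {a b} → a %ℕ n ≡ b %ℕ n → a ≡ b ⟨mod n ⟩
      %ℕ≡⇒≡mod {a} {b} eq =
        ≡mod-trans (≡mod-sym (%ℕ-≡mod a)) (subst (λ r → + r ≡ b ⟨mod n ⟩) (sym eq) (%ℕ-≡mod b))

  module ≡mod-Reasoning {n : ℕ} = SetoidReasoning (≡mod-setoid {n})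

  closedWalkEdges : {A : Set} → List A → List (A × A)
  closedWalkEdges []       = []
  closedWalkEdges (v ∷ vs) = zip (v ∷ vs) (vs ++ [ v ])

  cycleEdges-map : ∀ {A : Set} (f : A → ℕ) C → cycleEdges (map f C) ≡ map (Product.map f f) (closedWalkEdges C)
  cycleEdges-map f []       = refl
  cycleEdges-map f (v ∷ vs) = trans (cong (zip (map f (v ∷ vs))) (sym (LP.map-++ f vs [ v ]))) (LP.zip-map f f (v ∷ vs) (vs ++ [ v ]))

  length-closedWalkEdges : ∀ {A : Set} (C : List A) → length (closedWalkEdges C) ≡ length C
  length-closedWalkEdges []       = refl
  length-closedWalkEdges (v ∷ vs) = length-zip (v ∷ vs) (vs ++ [ v ]) (sym (trans (LP.length-++ vs) (ℕP.+-comm (length vs) 1)))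
    where
    length-zip : ∀ {A : Set} (xs ys : List A) → length xs ≡ length ys → length (zip xs ys) ≡ length xs
    length-zip []       ys       _  = refl
    length-zip (x ∷ xs) (y ∷ ys) eq = cong suc (length-zip xs ys (ℕP.suc-injective eq))

  data OrientedEdge (C : List ℤ) (u v : ℤ) : Set where
    forward  : (u , v) ∈ closedWalkEdges C → OrientedEdge C u v
    backward : (v , u) ∈ closedWalkEdges C → OrientedEdge C u v

  hasEdge-map⁺ : ∀ {f : ℤ → ℕ} {C u v} → OrientedEdge C u v → HasEdge (map f C) (f u) (f v)
  hasEdge-map⁺ {f} {C} (forward uv∈C)  = inj₁ (subst (_ ∈_) (sym (cycleEdges-map f C)) (∈P.∈-map⁺ (Product.map f f) uv∈C))
  hasEdge-map⁺ {f} {C} (backward vu∈C) = inj₂ (subst (_ ∈_) (sym (cycleEdges-map f C)) (∈P.∈-map⁺ (Product.map f f) vu∈C))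

  hasEdge-map⁻ : ∀ {f : ℤ → ℕ} {C x y} → HasEdge (map f C) x y →
                 ∃₂ λ u v → OrientedEdge C u v × f u ≡ x × f v ≡ y
  hasEdge-map⁻ {f} {C} (inj₁ xy∈fC) with ∈P.∈-map⁻ (Product.map f f) (subst (_ ∈_) (cycleEdges-map f C) xy∈fC)
  ... | (u , v) , uv∈C , refl = u , v , forward uv∈C , refl , refl
  hasEdge-map⁻ {f} {C} (inj₂ yx∈fC) with ∈P.∈-map⁻ (Product.map f f) (subst (_ ∈_) (cycleEdges-map f C) yx∈fC)
  ... | (v , u) , vu∈C , refl = u , v , backward vu∈C , refl , refl

  edgeLength : ℤ × ℤ → ℕ
  edgeLength (u , v) = ∣ v - u ∣

  edgeLengths : List ℤ → List ℕ
  edgeLengths C = map edgeLength (closedWalkEdges C)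

  length-edgeLengths : ∀ C → length (edgeLengths C) ≡ length C
  length-edgeLengths C = trans (LP.length-map edgeLength (closedWalkEdges C)) (length-closedWalkEdges C)

  orientedEdge-length∈ : ∀ {C u v} → OrientedEdge C u v → ∣ v - u ∣ ∈ edgeLengths C
  orientedEdge-length∈ (forward uv∈C) = ∈P.∈-map⁺ edgeLength uv∈C
  orientedEdge-length∈ {u = u} {v} (backward vu∈C) = subst (_∈ _) (ℤP.∣i-j∣≡∣j-i∣ u v) (∈P.∈-map⁺ edgeLength vu∈C)

  ∣i∣≡∣j∣⇒i≡j⊎i≡-j : ∀ {i j} → ∣ i ∣ ≡ ∣ j ∣ → i ≡ j ⊎ i ≡ - j
  ∣i∣≡∣j∣⇒i≡j⊎i≡-j {i} {j} eq with ℤP.+∣i∣≡i⊎+∣i∣≡-i i | ℤP.+∣i∣≡i⊎+∣i∣≡-i j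
  ... | inj₁ i≡ | inj₁ j≡ = inj₁ (trans (sym i≡) (trans (cong +_ eq) j≡))
  ... | inj₁ i≡ | inj₂ j≡ = inj₂ (trans (sym i≡) (trans (cong +_ eq) j≡))
  ... | inj₂ i≡ | inj₁ j≡ =
    inj₂ (ℤP.neg-injective (trans (sym i≡) (trans (cong +_ eq) (trans j≡ (sym (ℤP.neg-involutive j))))))
  ... | inj₂ i≡ | inj₂ j≡ = inj₁ (ℤP.neg-injective (trans (sym i≡) (trans (cong +_ eq) j≡)))

  i-j≡-[j-i] : ∀ i j → i - j ≡ - (j - i)
  i-j≡-[j-i] = solve-∀

  i≡-i⇒i≡0 : ∀ {i} → i ≡ - i → i ≡ + 0
  i≡-i⇒i≡0 {+ zero}    _  = refl
  i≡-i⇒i≡0 {+ suc _}   ()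
  i≡-i⇒i≡0 { -[1+ _ ]} ()

  Unique-map⇒injective : ∀ {A B : Set} (g : A → B) {L a b} → Unique (map g L) → a ∈ L → b ∈ L → g a ≡ g b → a ≡ b
  Unique-map⇒injective g {_ ∷ _} _            (here refl) (here refl) _  = refl
  Unique-map⇒injective g {_ ∷ _} (ga∉ ∷ _)    (here refl) (there b∈)  eq = contradiction eq (All.lookup ga∉ (∈P.∈-map⁺ g b∈))
  Unique-map⇒injective g {_ ∷ _} (gb∉ ∷ _)    (there a∈)  (here refl) eq = contradiction (sym eq) (All.lookup gb∉ (∈P.∈-map⁺ g a∈))
  Unique-map⇒injective g {_ ∷ _} (_ ∷ unique) (there a∈)  (there b∈)  eq = Unique-map⇒injective g unique a∈ b∈ eq

  orientedEdge-of-length : ∀ {C d} → ∣ d ∣ ∈ edgeLengths C → ∃₂ λ u v → OrientedEdge C u v × v - u ≡ d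
  orientedEdge-of-length {d = d} ∣d∣∈ with ∈P.∈-map⁻ edgeLength ∣d∣∈
  ... | (u , v) , uv∈C , ∣d∣≡ with ∣i∣≡∣j∣⇒i≡j⊎i≡-j (sym ∣d∣≡)
  ...   | inj₁ v-u≡d  = u , v , forward uv∈C , v-u≡d
  ...   | inj₂ v-u≡-d = v , u , backward uv∈C , (begin
          u - v     ≡⟨ i-j≡-[j-i] u v ⟩
          - (v - u) ≡⟨ cong -_ v-u≡-d ⟩
          - - d     ≡⟨ ℤP.neg-involutive d ⟩
          d         ∎)
    where open ≡-Reasoning

  orientedEdge-unique : ∀ {C u v u′ v′} → Unique (edgeLengths C) → OrientedEdge C u v → OrientedEdge C u′ v′ →
                        v - u ≡ v′ - u′ → v - u ≢ + 0 → u ≡ u′ × v ≡ v′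
  orientedEdge-unique {C} {u} {v} {u′} {v′} unique e e′ eq nonzero = cases e e′
    where
    same : ∀ {a b} → a ∈ closedWalkEdges C → b ∈ closedWalkEdges C → edgeLength a ≡ edgeLength b → a ≡ b
    same = Unique-map⇒injective edgeLength unique
    flipped : ∣ v - u ∣ ≡ ∣ u′ - v′ ∣
    flipped = trans (cong ∣_∣ eq) (ℤP.∣i-j∣≡∣j-i∣ v′ u′)
    reflipped : ∣ u - v ∣ ≡ ∣ v′ - u′ ∣
    reflipped = trans (ℤP.∣i-j∣≡∣j-i∣ u v) (cong ∣_∣ eq)
    not-reversed : u ≡ v′ × v ≡ u′ → u ≡ u′ × v ≡ v′
    not-reversed (u≡v′ , v≡u′) = contradiction (i≡-i⇒i≡0 (begin
      v - u   ≡⟨ eq ⟩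
      v′ - u′ ≡⟨ cong₂ _-_ (sym u≡v′) (sym v≡u′) ⟩
      u - v   ≡⟨ i-j≡-[j-i] u v ⟩
      - (v - u) ∎)) nonzero
      where open ≡-Reasoning
    cases : OrientedEdge C u v → OrientedEdge C u′ v′ → u ≡ u′ × v ≡ v′
    cases (forward uv∈) (forward uv∈′) = ,-injective (same uv∈ uv∈′ (cong ∣_∣ eq))
    cases (backward vu∈) (backward vu∈′) = Product.swap (,-injective (same vu∈ vu∈′ (trans reflipped (ℤP.∣i-j∣≡∣j-i∣ v′ u′))))
    cases (forward uv∈) (backward vu∈′) = not-reversed (,-injective (same uv∈ vu∈′ flipped))
    cases (backward vu∈) (forward uv∈′) = not-reversed (Product.swap (,-injective (same vu∈ uv∈′ reflipped)))

  -- Alternating walks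

  walkEnd : ℤ → Bool → List ℕ → ℤ
  walkEnd acc _     []       = acc
  walkEnd acc true  (d ∷ ds) = walkEnd (acc - + d) false ds
  walkEnd acc false (d ∷ ds) = walkEnd (acc + + d) true ds

  stepLengths-partials : ∀ prev acc b ds →
    map edgeLength (zip (prev ∷ partials acc b ds) (partials acc b ds ++ [ walkEnd acc b ds ])) ≡ ∣ acc - prev ∣ ∷ ds
  stepLengths-partials prev acc b     []       = refl
  stepLengths-partials prev acc true  (d ∷ ds) = cong (∣ acc - prev ∣ ∷_)
    (trans (stepLengths-partials acc (acc - + d) false ds) (cong (_∷ ds) (∣[i-+d]-i∣≡d acc d)))
    where
    ∣[i-+d]-i∣≡d : ∀ i d → ∣ (i - + d) - i ∣ ≡ d
    ∣[i-+d]-i∣≡d i d = trans (cong ∣_∣ ([i-d]-i≡-d i (+ d))) (ℤP.∣-i∣≡∣i∣ (+ d))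
      where [i-d]-i≡-d : ∀ i d → (i - d) - i ≡ - d
            [i-d]-i≡-d = solve-∀
  stepLengths-partials prev acc false (d ∷ ds) = cong (∣ acc - prev ∣ ∷_)
    (trans (stepLengths-partials acc (acc + + d) true ds) (cong (_∷ ds) (cong ∣_∣ ([i+d]-i≡d acc (+ d)))))
    where
    [i+d]-i≡d : ∀ i d → (i + d) - i ≡ d
    [i+d]-i≡d = solve-∀

  closedWalk-edgeLengths : ∀ ds → walkEnd (+ 0) true ds ≡ + 0 → edgeLengths (partials (+ 0) true ds) ≡ ds
  closedWalk-edgeLengths []       _      = refl
  closedWalk-edgeLengths (d ∷ ds) closes = begin
    map edgeLength (zip (+ 0 ∷ P) (P ++ [ + 0 ]))
      ≡⟨ cong (λ end → map edgeLength (zip (+ 0 ∷ P) (P ++ [ end ]))) (sym closes) ⟩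
    map edgeLength (zip (+ 0 ∷ P) (P ++ [ walkEnd (+ 0 - + d) false ds ]))
      ≡⟨ stepLengths-partials (+ 0) (+ 0 - + d) false ds ⟩
    ∣ (+ 0 - + d) - + 0 ∣ ∷ ds
      ≡⟨ cong (_∷ ds) (trans (cong ∣_∣ ([0-d]-0≡-d (+ d))) (ℤP.∣-i∣≡∣i∣ (+ d))) ⟩
    d ∷ ds ∎
    where
    open ≡-Reasoning
    P : List ℤ
    P = partials (+ 0 - + d) false ds
    [0-d]-0≡-d : ∀ d → (+ 0 - d) - + 0 ≡ - d
    [0-d]-0≡-d = solve-∀

  -- Invariant of the walk: standing at acc after a step of length lo, all later vertices avoid the gap
  -- [acc - lo, acc) and stay within [-M, M].
  Band : ℕ → ℤ → ℕ → ℤ → Set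
  Band M acc lo x = (acc ≤ x × x ≤ + M) ⊎ (- + M ≤ x × x < acc - + lo)

  Band-here : ∀ {M acc lo} → acc ≤ + lo → lo ℕ.≤ M → Band M acc lo acc
  Band-here acc≤lo lo≤M = inj₁ (ℤP.≤-refl , ℤP.≤-trans acc≤lo (ℤ.+≤+ lo≤M))

  i-+n<i-+m : ∀ i {m n} → m ℕ.< n → i - + n < i - + m
  i-+n<i-+m i m<n = ℤP.+-monoʳ-< i (ℤP.neg-mono-< (ℤ.+<+ m<n))

  i-+n<i : ∀ i {n} → 0 ℕ.< n → i - + n < i
  i-+n<i i {n} 0<n = subst (i - + n <_) (ℤP.+-identityʳ i) (i-+n<i-+m i 0<n)

  Band-next : ∀ {M acc lo a} → + 0 ≤ acc → lo ℕ.< a → a ℕ.≤ M → Band M acc lo (acc - + a)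
  Band-next {M} {acc} {lo} {a} 0≤acc lo<a a≤M = inj₂ (-M≤acc-a , i-+n<i-+m acc lo<a)
    where
    -M≤acc-a : - + M ≤ acc - + a
    -M≤acc-a = ℤP.≤-trans (ℤP.neg-mono-≤ (ℤ.+≤+ a≤M))
      (subst (_≤ acc - + a) (ℤP.+-identityˡ (- + a)) (ℤP.+-monoˡ-≤ (- + a) 0≤acc))

  Band⇒∣∣≤ : ∀ {M x} → Band M (+ 0) 0 x → ∣ x ∣ ℕ.≤ M
  Band⇒∣∣≤ {x = + _}      (inj₁ (_ , ℤ.+≤+ x≤M)) = x≤M
  Band⇒∣∣≤ {x = + _}      (inj₂ (_ , ℤ.+<+ ()))
  Band⇒∣∣≤ {x = -[1+ _ ]} (inj₁ (() , _))
  Band⇒∣∣≤ {x = -[1+ _ ]} (inj₂ (-M≤x , _)) with ℤP.neg-cancel-≤ -M≤x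
  ... | ℤ.+≤+ ∣x∣≤M = ∣x∣≤M

  zigzag : ∀ M acc lo F z → + 0 ≤ acc → acc ≤ + lo → StrictlyIncreasing (lo ∷ F) → All (ℕ._≤ M) (lo ∷ F) →
           Unique (partials acc true (F ++ [ z ])) × All (Band M acc lo) (partials acc true (F ++ [ z ]))
  zigzag M acc lo [] z 0≤acc acc≤lo _ (lo≤M ∷ _) = ([] ∷ []) , (Band-here acc≤lo lo≤M ∷ [])
  zigzag M acc lo (a ∷ []) z 0≤acc acc≤lo (lo<a ∷ _) (lo≤M ∷ a≤M ∷ _) =
    ((≢-sym (ℤP.<⇒≢ (i-+n<i acc (ℕP.≤-<-trans z≤n lo<a))) ∷ []) ∷ ([] ∷ [])) ,
    (Band-here acc≤lo lo≤M ∷ Band-next 0≤acc lo<a a≤M ∷ [])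
  zigzag M acc lo (a ∷ b ∷ F) z 0≤acc acc≤lo (lo<a ∷ a<b ∷ linked) (lo≤M ∷ a≤M ∷ b≤M∷F≤M)
    = ((≢-sym (ℤP.<⇒≢ acc-a<acc) ∷ All.map acc∉ bands) ∷ (All.map acc-a∉ bands ∷ unique)) ,
    (Band-here acc≤lo lo≤M ∷ Band-next 0≤acc lo<a a≤M ∷ All.map widen bands)
    where
    acc′ : ℤ
    acc′ = (acc - + a) + + b
    acc-a<acc : acc - + a < acc
    acc-a<acc = i-+n<i acc (ℕP.≤-<-trans z≤n lo<a)
    acc<acc′ : acc < acc′
    acc<acc′ = subst (_< acc′) ([i-a]+a≡i acc (+ a)) (ℤP.+-monoʳ-< (acc - + a) (ℤ.+<+ a<b))
      where [i-a]+a≡i : ∀ i a → (i - a) + a ≡ i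
            [i-a]+a≡i = solve-∀
    acc′≤b : acc′ ≤ + b
    acc′≤b = subst (acc′ ≤_) (ℤP.+-identityˡ (+ b))
      (ℤP.+-monoˡ-≤ (+ b) (ℤP.i≤j⇒i-j≤0 (ℤP.≤-trans acc≤lo (ℤ.+≤+ (ℕP.<⇒≤ lo<a)))))
    acc′-b≡acc-a : acc′ - + b ≡ acc - + a
    acc′-b≡acc-a = [i+b]-b≡i (acc - + a) (+ b)
      where [i+b]-b≡i : ∀ i b → (i + b) - b ≡ i
            [i+b]-b≡i = solve-∀
    below-acc-a : ∀ {x} → x < acc′ - + b → x < acc - + a
    below-acc-a = subst (_ <_) acc′-b≡acc-a
    acc∉ : ∀ {x} → Band M acc′ b x → acc ≢ x
    acc∉ (inj₁ (acc′≤x , _)) = ℤP.<⇒≢ (ℤP.<-≤-trans acc<acc′ acc′≤x)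
    acc∉ (inj₂ (_ , x<))     = ≢-sym (ℤP.<⇒≢ (ℤP.<-trans (below-acc-a x<) acc-a<acc))
    acc-a∉ : ∀ {x} → Band M acc′ b x → acc - + a ≢ x
    acc-a∉ (inj₁ (acc′≤x , _)) = ℤP.<⇒≢ (ℤP.<-≤-trans (ℤP.<-trans acc-a<acc acc<acc′) acc′≤x)
    acc-a∉ (inj₂ (_ , x<))     = ≢-sym (ℤP.<⇒≢ (below-acc-a x<))
    widen : ∀ {x} → Band M acc′ b x → Band M acc lo x
    widen (inj₁ (acc′≤x , x≤M)) = inj₁ (ℤP.≤-trans (ℤP.<⇒≤ acc<acc′) acc′≤x , x≤M)
    widen (inj₂ (-M≤x , x<))    = inj₂ (-M≤x , ℤP.<-trans (below-acc-a x<) (i-+n<i-+m acc lo<a))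
    rest : Unique (partials acc′ true (F ++ [ z ])) × All (Band M acc′ b) (partials acc′ true (F ++ [ z ]))
    rest = zigzag M acc′ b F z (ℤP.≤-trans 0≤acc (ℤP.<⇒≤ acc<acc′)) acc′≤b linked b≤M∷F≤M
    unique : Unique (partials acc′ true (F ++ [ z ]))
    unique = proj₁ rest
    bands : All (Band M acc′ b) (partials acc′ true (F ++ [ z ]))
    bands = proj₂ rest

  flat : List (ℕ × ℕ) → List ℕ
  flat []            = []
  flat ((a , b) ∷ P) = a ∷ b ∷ flat P

  diff : ℕ × ℕ → ℕ
  diff (a , b) = b ∸ a

  flat-++ : ∀ P Q → flat (P ++ Q) ≡ flat P ++ flat Q
  flat-++ []            Q = refl
  flat-++ ((a , b) ∷ P) Q = cong (λ R → a ∷ b ∷ R) (flat-++ P Q)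

  length-flat : ∀ P → length (flat P) ≡ length P ℕ.+ length P
  length-flat []            = refl
  length-flat ((a , b) ∷ P) = cong suc (trans (cong suc (length-flat P)) (sym (ℕP.+-suc (length P) (length P))))

  altPattern-flat : ∀ P → altPattern (flat P) ≡ map diff P
  altPattern-flat []            = refl
  altPattern-flat ((a , b) ∷ P) = cong (b ∸ a ∷_) (altPattern-flat P)

  length-altPattern-flat : ∀ P → length (altPattern (flat P)) ≡ length P
  length-altPattern-flat P = trans (cong length (altPattern-flat P)) (LP.length-map diff P)

  unflatten : ∀ k D → length D ≡ k ℕ.+ k → ∃[ P ] D ≡ flat P
  unflatten zero    []          _  = [] , refl
  unflatten (suc k) (a ∷ b ∷ D) eq with unflatten k D (ℕP.suc-injective (trans (ℕP.suc-injective eq) (ℕP.+-suc k k)))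
  ... | P , refl = (a , b) ∷ P , refl
  unflatten (suc k) (a ∷ []) eq with () ← trans (ℕP.suc-injective eq) (ℕP.+-suc k k)

  ordered-pairs : ∀ P → StrictlyIncreasing (flat P) → All (uncurry ℕ._≤_) P
  ordered-pairs []                      _                = []
  ordered-pairs ((a , b) ∷ [])          (a<b ∷ _)        = ℕP.<⇒≤ a<b ∷ []
  ordered-pairs ((a , b) ∷ (c , d) ∷ P) (a<b ∷ _ ∷ rest) = ℕP.<⇒≤ a<b ∷ ordered-pairs ((c , d) ∷ P) rest

  splitAt-index : ∀ {A : Set} t (P : List A) → t ℕ.< length P → ∃[ PA ] ∃[ x ] ∃[ PB ] P ≡ PA ++ x ∷ PB × length PA ≡ t
  splitAt-index zero    (x ∷ P) _ = [] , x , P , refl , refl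
  splitAt-index (suc t) (y ∷ P) (s≤s t<) with splitAt-index t P t<
  ... | PA , x , PB , refl , refl = y ∷ PA , x , PB , refl , refl

  take-++ : ∀ {A : Set} (X Y : List A) n → take (length X ℕ.+ n) (X ++ Y) ≡ X ++ take n Y
  take-++ []      Y n = refl
  take-++ (x ∷ X) Y n = cong (x ∷_) (take-++ X Y n)

  drop-++ : ∀ {A : Set} (X Y : List A) n → drop (length X ℕ.+ n) (X ++ Y) ≡ drop n Y
  drop-++ []      Y n = refl
  drop-++ (x ∷ X) Y n = drop-++ X Y n

  0∷-increasing : ∀ {D} → All (1 ℕ.≤_) D → StrictlyIncreasing D → StrictlyIncreasing (0 ∷ D)
  0∷-increasing []        _      = [-]
  0∷-increasing (1≤x ∷ _) linked = 1≤x ∷ linked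

  increasing⇒unique : ∀ {D} → StrictlyIncreasing D → Unique D
  increasing⇒unique linked = AllPairs.map ℕP.<⇒≢ (LinkedP.Linked⇒AllPairs ℕP.<-trans linked)

  increasing-delete : ∀ X {a b Y} → StrictlyIncreasing (X ++ a ∷ b ∷ Y) → StrictlyIncreasing (X ++ a ∷ Y)
  increasing-delete []          {Y = []}    _                 = [-]
  increasing-delete []          {Y = _ ∷ _} (a<b ∷ b<y ∷ rest) = ℕP.<-trans a<b b<y ∷ rest
  increasing-delete (x ∷ [])    (x<  ∷ rest) = x< ∷ increasing-delete [] rest
  increasing-delete (x ∷ y ∷ X) (x<y ∷ rest) = x<y ∷ increasing-delete (y ∷ X) rest

  Unique-resp-↭ : ∀ {xs ys : List ℕ} → xs ↭ ys → Unique xs → Unique ys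
  Unique-resp-↭ p = ↭ₛP.Unique-resp-↭ (≡.setoid ℕ) (↭⇒↭ₛ p)

  -- The cycle C(D) of a balanced set D

  deltas-split : ∀ PA p q PB →
    deltas (suc (length PA)) (flat (PA ++ (p , q) ∷ PB)) ≡ (flat PA ++ p ∷ flat PB) ++ [ q ]
  deltas-split PA p q PB = begin
    deltas (suc t) (flat (PA ++ (p , q) ∷ PB))
      ≡⟨ cong (deltas (suc t)) (flat-++ PA _) ⟩
    take (2 ℕ.* suc t ∸ 1) D ++ drop (2 ℕ.* suc t) D ++ take 1 (drop (2 ℕ.* suc t ∸ 1) D)
      ≡⟨ cong₂ (λ i j → take i D ++ drop j D ++ take 1 (drop i D)) odd even ⟩
    take (length X ℕ.+ 1) D ++ drop (length X ℕ.+ 2) D ++ take 1 (drop (length X ℕ.+ 1) D)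
      ≡⟨ cong₂ (λ A B → A ++ B ++ take 1 (drop (length X ℕ.+ 1) D)) (take-++ X _ 1) (drop-++ X _ 2) ⟩
    (X ++ [ p ]) ++ flat PB ++ take 1 (drop (length X ℕ.+ 1) D)
      ≡⟨ cong (λ A → (X ++ [ p ]) ++ flat PB ++ take 1 A) (drop-++ X _ 1) ⟩
    (X ++ [ p ]) ++ flat PB ++ [ q ]
      ≡⟨ LP.++-assoc X [ p ] _ ⟩
    X ++ p ∷ flat PB ++ [ q ]
      ≡⟨ LP.++-assoc X (p ∷ flat PB) [ q ] ⟨
    (X ++ p ∷ flat PB) ++ [ q ] ∎
    where
    open ≡-Reasoning
    t : ℕ
    t = length PA
    X D : List ℕ
    X = flat PA
    D = X ++ p ∷ q ∷ flat PB
    t+[1+t]≡[t+t]+1 : ∀ t → t ℕ.+ suc (t ℕ.+ 0) ≡ (t ℕ.+ t) ℕ.+ 1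
    t+[1+t]≡[t+t]+1 = solveℕ-∀
    odd : 2 ℕ.* suc t ∸ 1 ≡ length X ℕ.+ 1
    odd = trans (t+[1+t]≡[t+t]+1 t) (cong (ℕ._+ 1) (sym (length-flat PA)))
    even : 2 ℕ.* suc t ≡ length X ℕ.+ 2
    even = trans (cong suc odd) (sym (ℕP.+-suc (length X) 1))

  balanced-split : ∀ PA p q PB → BalancedWith (suc (length PA)) (flat (PA ++ (p , q) ∷ PB)) →
                   sum (map diff PA) ℕ.+ (q ∸ p) ≡ sum (map diff PB)
  balanced-split PA p q PB (_ , _ , balanced) = begin
    sum (map diff PA) ℕ.+ (q ∸ p)        ≡⟨ cong (sum (map diff PA) ℕ.+_) (ℕP.+-identityʳ (q ∸ p)) ⟨
    sum (map diff PA) ℕ.+ sum [ q ∸ p ]  ≡⟨ ΣP.sum-++ (map diff PA) [ q ∸ p ] ⟨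
    sum (map diff PA ++ [ q ∸ p ])       ≡⟨ cong sum (take-++ (map diff PA) _ 1) ⟨
    sum (take (length Δ ℕ.+ 1) L)        ≡⟨ cong (λ A → sum (take (length Δ ℕ.+ 1) A)) altPattern≡ ⟨
    sum (take (length Δ ℕ.+ 1) (altPattern D)) ≡⟨ cong (λ i → sum (take i (altPattern D))) length≡ ⟩
    sum (take (suc (length PA)) (altPattern D)) ≡⟨ balanced ⟩
    sum (drop (suc (length PA)) (altPattern D)) ≡⟨ cong (λ i → sum (drop i (altPattern D))) length≡ ⟨
    sum (drop (length Δ ℕ.+ 1) (altPattern D)) ≡⟨ cong (λ A → sum (drop (length Δ ℕ.+ 1) A)) altPattern≡ ⟩
    sum (drop (length Δ ℕ.+ 1) L)        ≡⟨ cong sum (drop-++ Δ _ 1) ⟩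
    sum (map diff PB)                    ∎
    where
    open ≡-Reasoning
    D Δ L : List ℕ
    D = flat (PA ++ (p , q) ∷ PB)
    Δ = map diff PA
    L = Δ ++ (q ∸ p) ∷ map diff PB
    altPattern≡ : altPattern D ≡ L
    altPattern≡ = trans (altPattern-flat (PA ++ (p , q) ∷ PB)) (LP.map-++ diff PA _)
    length≡ : length Δ ℕ.+ 1 ≡ suc (length PA)
    length≡ = trans (ℕP.+-comm (length Δ) 1) (cong suc (LP.length-map diff PA))

  +[b∸a+s]≡[+b-+a]++s : ∀ {a b} s → a ℕ.≤ b → + (b ∸ a ℕ.+ s) ≡ (+ b - + a) + + s
  +[b∸a+s]≡[+b-+a]++s {a} {b} s a≤b = trans (ℤP.pos-+ (b ∸ a) s)
    (cong (_+ + s) (sym (trans (ℤP.[+m]-[+n]≡m⊖n b a) (ℤP.⊖-≥ a≤b))))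

  walkEnd-flat-true : ∀ acc P R → All (uncurry ℕ._≤_) P →
                      walkEnd acc true (flat P ++ R) ≡ walkEnd (acc + + sum (map diff P)) true R
  walkEnd-flat-true acc []            R []                = cong (λ x → walkEnd x true R) (sym (ℤP.+-identityʳ acc))
  walkEnd-flat-true acc ((a , b) ∷ P) R (a≤b ∷ ordered) =
    trans (walkEnd-flat-true ((acc - + a) + + b) P R ordered) (cong (λ x → walkEnd x true R) (begin
      (acc - + a) + + b + + s      ≡⟨ reassoc acc (+ a) (+ b) (+ s) ⟩
      acc + ((+ b - + a) + + s)    ≡⟨ cong (λ x → acc + x) (+[b∸a+s]≡[+b-+a]++s s a≤b) ⟨
      acc + + (b ∸ a ℕ.+ s)        ∎))
    where
    open ≡-Reasoning
    s : ℕ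
    s = sum (map diff P)
    reassoc : ∀ acc a b s → (acc - a) + b + s ≡ acc + ((b - a) + s)
    reassoc = solve-∀

  walkEnd-flat-false : ∀ acc P R → All (uncurry ℕ._≤_) P →
                       walkEnd acc false (flat P ++ R) ≡ walkEnd (acc - + sum (map diff P)) false R
  walkEnd-flat-false acc []            R []                = cong (λ x → walkEnd x false R) (sym (ℤP.+-identityʳ acc))
  walkEnd-flat-false acc ((a , b) ∷ P) R (a≤b ∷ ordered) =
    trans (walkEnd-flat-false ((acc + + a) - + b) P R ordered) (cong (λ x → walkEnd x false R) (begin
      (acc + + a) - + b - + s      ≡⟨ reassoc acc (+ a) (+ b) (+ s) ⟩
      acc - ((+ b - + a) + + s)    ≡⟨ cong (λ x → acc - x) (+[b∸a+s]≡[+b-+a]++s s a≤b) ⟨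
      acc - + (b ∸ a ℕ.+ s)        ∎))
    where
    open ≡-Reasoning
    s : ℕ
    s = sum (map diff P)
    reassoc : ∀ acc a b s → (acc + a) - b - s ≡ acc - ((b - a) + s)
    reassoc = solve-∀

  walkEnd-closes : ∀ PA p q PB → All (uncurry ℕ._≤_) PA → p ℕ.≤ q → All (uncurry ℕ._≤_) PB →
                   sum (map diff PA) ℕ.+ (q ∸ p) ≡ sum (map diff PB) →
                   walkEnd (+ 0) true ((flat PA ++ p ∷ flat PB) ++ [ q ]) ≡ + 0
  walkEnd-closes PA p q PB orderedA p≤q orderedB balanced = begin
    walkEnd (+ 0) true ((flat PA ++ p ∷ flat PB) ++ [ q ])    ≡⟨ cong (walkEnd (+ 0) true) (LP.++-assoc (flat PA) _ [ q ]) ⟩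
    walkEnd (+ 0) true (flat PA ++ p ∷ flat PB ++ [ q ])      ≡⟨ walkEnd-flat-true (+ 0) PA _ orderedA ⟩
    walkEnd (+ 0 + + sA - + p) false (flat PB ++ [ q ])       ≡⟨ walkEnd-flat-false _ PB _ orderedB ⟩
    + 0 + + sA - + p - + sB + + q                             ≡⟨ regroup (+ sA) (+ p) (+ q) (+ sB) ⟩
    (+ sA + ((+ q - + p) + + 0)) - + sB                      ≡⟨ cong (λ x → (+ sA + x) - + sB) (+[b∸a+s]≡[+b-+a]++s 0 p≤q) ⟨
    (+ sA + + (q ∸ p ℕ.+ 0)) - + sB                           ≡⟨ cong (λ x → (+ sA + + x) - + sB) (ℕP.+-identityʳ (q ∸ p)) ⟩
    (+ sA + + (q ∸ p)) - + sB                                 ≡⟨ cong (_- + sB) (trans (sym (ℤP.pos-+ sA (q ∸ p))) (cong +_ balanced)) ⟩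
    + sB - + sB                                               ≡⟨ ℤP.+-inverseʳ (+ sB) ⟩
    + 0                                                       ∎
    where
    open ≡-Reasoning
    sA sB : ℕ
    sA = sum (map diff PA)
    sB = sum (map diff PB)
    regroup : ∀ sA p q sB → + 0 + sA - p - sB + q ≡ (sA + ((q - p) + + 0)) - sB
    regroup = solve-∀

  record IsStarter (M : ℕ) (D : List ℕ) (C : List ℤ) : Set where
    field
      unique             : Unique C
      bounded            : All (λ c → ∣ c ∣ ℕ.≤ M) C
      edgeLengths-unique : Unique (edgeLengths C)
      edgeLengths↭       : edgeLengths C ↭ D

  starter-split : ∀ {M} PA p q PB → let D = flat (PA ++ (p , q) ∷ PB) in
    StrictlyIncreasing D → BalancedWith (suc (length PA)) D → (∀ x → x ∈ D → 1 ℕ.≤ x × x ℕ.≤ M) →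
    IsStarter M D (cycleC (suc (length PA)) D)
  starter-split {M} PA p q PB increasing balanced bounded rewrite deltas-split PA p q PB = record
    { unique             = proj₁ vertices
    ; bounded            = All.map Band⇒∣∣≤ (proj₂ vertices)
    ; edgeLengths-unique = Unique-resp-↭ (↭-sym lengths↭) (increasing⇒unique increasing)
    ; edgeLengths↭       = lengths↭
    }
    where
    D F : List ℕ
    D = flat (PA ++ (p , q) ∷ PB)
    F = flat PA ++ p ∷ flat PB
    steps↭ : F ++ [ q ] ↭ D
    steps↭ = subst₂ _↭_ (sym (LP.++-assoc (flat PA) (p ∷ flat PB) [ q ])) (sym (flat-++ PA _))
      (↭P.++⁺ˡ (flat PA) (prep p (↭P.++-comm (flat PB) [ q ])))
    ordered : All (uncurry ℕ._≤_) (PA ++ (p , q) ∷ PB)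
    ordered = ordered-pairs _ increasing
    orderedPB : All (uncurry ℕ._≤_) ((p , q) ∷ PB)
    orderedPB = AllP.++⁻ʳ PA ordered
    closes : walkEnd (+ 0) true (F ++ [ q ]) ≡ + 0
    closes = walkEnd-closes PA p q PB (AllP.++⁻ˡ PA ordered) (All.head orderedPB) (All.tail orderedPB)
      (balanced-split PA p q PB balanced)
    lengths↭ : edgeLengths (partials (+ 0) true (F ++ [ q ])) ↭ D
    lengths↭ = subst (_↭ D) (sym (closedWalk-edgeLengths _ closes)) steps↭
    0∷F-increasing : StrictlyIncreasing (0 ∷ F)
    0∷F-increasing = increasing-delete (0 ∷ flat PA)
      (subst (λ A → StrictlyIncreasing (0 ∷ A)) (flat-++ PA _)
        (0∷-increasing (All.tabulate (λ x∈ → proj₁ (bounded _ x∈))) increasing))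
    0∷F≤M : All (ℕ._≤ M) (0 ∷ F)
    0∷F≤M = z≤n ∷ All.tabulate (λ x∈F → proj₂ (bounded _ (↭P.∈-resp-↭ steps↭ (∈P.∈-++⁺ˡ x∈F))))
    vertices : Unique (partials (+ 0) true (F ++ [ q ])) × All (Band M (+ 0) 0) (partials (+ 0) true (F ++ [ q ]))
    vertices = zigzag M (+ 0) 0 F q ℤP.≤-refl ℤP.≤-refl 0∷F-increasing 0∷F≤M

  starter : ∀ {M} k τ D → StrictlyIncreasing D → length D ≡ 2 ℕ.* k → BalancedWith τ D →
            (∀ x → x ∈ D → 1 ℕ.≤ x × x ℕ.≤ M) → IsStarter M D (cycleC τ D)
  starter k τ D increasing length≡ balanced bounded
    with unflatten k D (trans length≡ (cong (k ℕ.+_) (ℕP.+-identityʳ k)))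
  ... | P , refl with balanced
  ... | s≤s z≤n , τ≤ , _ with splitAt-index _ P (subst (ℕ._≤_ _) (length-altPattern-flat P) τ≤)
  ... | PA , (p , q) , PB , refl , refl = starter-split PA p q PB increasing balanced bounded

  -- Translates modulo 2M + 1

  Unique-map⁺ : ∀ {A B : Set} {P : A → Set} {f : A → B} {xs} → (∀ {x y} → P x → P y → f x ≡ f y → x ≡ y) →
                All P xs → Unique xs → Unique (map f xs)
  Unique-map⁺ injective []         []             = []
  Unique-map⁺ injective (px ∷ pxs) (x∉ ∷ unique) =
    AllP.map⁺ (All.zipWith (λ (x≢y , py) fx≡fy → x≢y (injective px py fx≡fy)) (x∉ , pxs))
    ∷ Unique-map⁺ injective pxs unique

  module Decomposition (M N : ℕ) (M+M≡N : M ℕ.+ M ≡ N) {m : ℕ}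
    (D : Fin m → List ℕ) (C : Fin m → List ℤ) (starter : ∀ i → IsStarter M (D i) (C i))
    (D-bounded : ∀ i x → x ∈ D i → 1 ℕ.≤ x × x ℕ.≤ M)
    (D-partition : ∀ x → 1 ℕ.≤ x → x ℕ.≤ M → ∃! _≡_ (λ i → x ∈ D i)) where

    n : ℕ
    n = suc N

    vertex : ℕ → ℤ → ℕ
    vertex j c = toZn n (c + + j)

    ∣i-j∣<n : ∀ a b → ∣ a ∣ ℕ.≤ M → ∣ b ∣ ℕ.≤ M → ∣ a - b ∣ ℕ.< n
    ∣i-j∣<n a b ∣a∣≤M ∣b∣≤M = ℕP.≤-<-trans (ℤP.∣i-j∣≤∣i∣+∣j∣ a b)
      (ℕP.≤-<-trans (ℕP.+-mono-≤ ∣a∣≤M ∣b∣≤M) (ℕP.≤-<-trans (ℕP.≤-reflexive M+M≡N) (ℕP.n<1+n N)))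

    vertex-≡mod : ∀ j c → + vertex j c ≡ c + + j ⟨mod n ⟩
    vertex-≡mod j c = %ℕ-≡mod (c + + j)

    vertex-≡⇒≡mod : ∀ j c j′ c′ → vertex j c ≡ vertex j′ c′ → c + + j ≡ c′ + + j′ ⟨mod n ⟩
    vertex-≡⇒≡mod j c j′ c′ = %ℕ≡⇒≡mod

    vertex-≡ : ∀ j c {x} → c + + j ≡ + x ⟨mod n ⟩ → x ℕ.< n → vertex j c ≡ x
    vertex-≡ j c c+j≡x x<n = trans (≡mod⇒%ℕ≡ c+j≡x) (m<n⇒m%n≡m x<n)

    vertex-injective : ∀ {j u u′} → ∣ u ∣ ℕ.≤ M → ∣ u′ ∣ ℕ.≤ M → vertex j u ≡ vertex j u′ → u ≡ u′
    vertex-injective {j} {u} {u′} ∣u∣≤M ∣u′∣≤M eq =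
      ≡mod∧small⇒≡ (+-cancelʳ-mod (+ j) (vertex-≡⇒≡mod j u j u′ eq)) (∣i-j∣<n u u′ ∣u∣≤M ∣u′∣≤M)

    translate-unique : ∀ i j → Unique (translateZn n (C i) j)
    translate-unique i j = Unique-map⁺ vertex-injective (IsStarter.bounded (starter i)) (IsStarter.unique (starter i))

    translate-bounded : ∀ c j → All (ℕ._< n) (translateZn n c j)
    translate-bounded c j = AllP.map⁺ (All.tabulate (λ {x} _ → n%ℕd<d (x + + j) n))

    translate-shift : ∀ c j g → shiftZn n g (translateZn n c j) ≡ translateZn n c ((+ (j ℕ.+ g)) %ℕ n)
    translate-shift c j g = trans (sym (LP.map-∘ c)) (LP.map-cong (λ x → ≡mod⇒%ℕ≡ (shifted x)) c)
      where
      open ≡mod-Reasoning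
      shifted : ∀ x → + (vertex j x ℕ.+ g) ≡ x + + ((+ (j ℕ.+ g)) %ℕ n) ⟨mod n ⟩
      shifted x = begin
        + (vertex j x ℕ.+ g)           ≡⟨ ℤP.pos-+ (vertex j x) g ⟩
        + vertex j x + + g             ≈⟨ +-congʳ-mod (+ g) (vertex-≡mod j x) ⟩
        x + + j + + g                  ≡⟨ trans (ℤP.+-assoc x (+ j) (+ g)) (cong (λ y → x + y) (sym (ℤP.pos-+ j g))) ⟩
        x + + (j ℕ.+ g)                ≈⟨ +-congˡ-mod x (≡mod-sym (%ℕ-≡mod (+ (j ℕ.+ g)))) ⟩
        x + + ((+ (j ℕ.+ g)) %ℕ n)     ∎

    translate-closed : ∀ c (j : Fin n) g →
                       ∃ λ (j′ : Fin n) → shiftZn n g (translateZn n c (toℕ j)) ≡ translateZn n c (toℕ j′)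
    translate-closed c j g = fromℕ< (n%ℕd<d (+ (toℕ j ℕ.+ g)) n) ,
      trans (translate-shift c (toℕ j) g) (cong (translateZn n c) (sym (FinP.toℕ-fromℕ< _)))

    balanced-residue : ∀ a → ∃[ d ] ∣ d ∣ ℕ.≤ M × a ≡ d ⟨mod n ⟩
    balanced-residue a with a %ℕ n ℕ.≤? M
    ... | yes r≤M = + (a %ℕ n) , r≤M , ≡mod-sym (%ℕ-≡mod a)
    ... | no  r≰M = + r - + n , ∣r-n∣≤M , a≡r-n
      where
      r : ℕ
      r = a %ℕ n
      r<n : r ℕ.< n
      r<n = n%ℕd<d a n
      ∣r-n∣≤M : ∣ + r - + n ∣ ℕ.≤ M
      ∣r-n∣≤M = begin
        ∣ + r - + n ∣ ≡⟨ cong ∣_∣ (ℤP.[+m]-[+n]≡m⊖n r n) ⟩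
        ∣ r ℤ.⊖ n ∣   ≡⟨ ℤP.∣⊖∣-< r<n ⟩
        n ∸ r         ≤⟨ ℕP.∸-monoʳ-≤ n (ℕP.≰⇒> r≰M) ⟩
        n ∸ suc M     ≡⟨ cong (_∸ M) (sym M+M≡N) ⟩
        M ℕ.+ M ∸ M   ≡⟨ ℕP.m+n∸m≡n M M ⟩
        M             ∎
        where open ℕP.≤-Reasoning
      a≡r-n : a ≡ + r - + n ⟨mod n ⟩
      a≡r-n = begin
        a             ≈⟨ ≡mod-sym (%ℕ-≡mod a) ⟩
        + r           ≡⟨ ℤP.+-identityʳ (+ r) ⟨
        + r - + 0     ≈⟨ +-congˡ-mod (+ r) (neg-cong-mod (≡mod-sym n≡0-mod)) ⟩
        + r - + n     ∎
        where open ≡mod-Reasoning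

    translate-onto : ∀ {c u v x y} → OrientedEdge c u v → v - u ≡ + y - + x ⟨mod n ⟩ → x ℕ.< n → y ℕ.< n →
            ∃[ j ] HasEdge (translateZn n c (toℕ j)) x y
    translate-onto {c} {u} {v} {x} {y} edge v-u≡y-x x<n y<n =
      j , subst₂ (HasEdge (translateZn n c (toℕ j))) (vertex-≡ (toℕ j) u u+j≡x x<n) (vertex-≡ (toℕ j) v v+j≡y y<n)
            (hasEdge-map⁺ {f = vertex (toℕ j)} {c} edge)
      where
      open ≡mod-Reasoning
      j : Fin n
      j = fromℕ< (n%ℕd<d (+ x - u) n)
      j≡x-u : + toℕ j ≡ + x - u ⟨mod n ⟩
      j≡x-u = subst (λ r → + r ≡ + x - u ⟨mod n ⟩) (sym (FinP.toℕ-fromℕ< _)) (%ℕ-≡mod (+ x - u))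
      u+j≡x : u + + toℕ j ≡ + x ⟨mod n ⟩
      u+j≡x = begin
        u + + toℕ j   ≈⟨ +-congˡ-mod u j≡x-u ⟩
        u + (+ x - u) ≡⟨ u+[x-u]≡x u (+ x) ⟩
        + x           ∎
        where u+[x-u]≡x : ∀ u x → u + (x - u) ≡ x
              u+[x-u]≡x = solve-∀
      v+j≡y : v + + toℕ j ≡ + y ⟨mod n ⟩
      v+j≡y = begin
        v + + toℕ j       ≈⟨ +-congˡ-mod v j≡x-u ⟩
        v + (+ x - u)     ≡⟨ regroup u v (+ x) ⟩
        (v - u) + + x     ≈⟨ +-congʳ-mod (+ x) v-u≡y-x ⟩
        (+ y - + x) + + x ≡⟨ [y-x]+x≡y (+ y) (+ x) ⟩
        + y               ∎
        where regroup : ∀ u v x → v + (x - u) ≡ (v - u) + x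
              regroup = solve-∀
              [y-x]+x≡y : ∀ y x → (y - x) + x ≡ y
              [y-x]+x≡y = solve-∀

    difference-nonzero : ∀ {x y d} → x ℕ.< n → y ℕ.< n → x ≢ y → + y - + x ≡ d ⟨mod n ⟩ → 1 ℕ.≤ ∣ d ∣
    difference-nonzero {x} {y} {d} x<n y<n x≢y y-x≡d with ∣ d ∣ in ∣d∣≡0
    ... | suc _ = s≤s z≤n
    ... | zero  = contradiction (sym (+-injective-mod y≡x y<n x<n)) x≢y
      where
      y≡x : + y ≡ + x ⟨mod n ⟩
      y≡x = +-cancelʳ-mod (- + x) (≡mod-trans y-x≡d
        (≡mod-reflexive (trans (ℤP.∣i∣≡0⇒i≡0 ∣d∣≡0) (sym (ℤP.+-inverseʳ (+ x))))))

    edge-exists : ∀ {x y} → x ℕ.< n → y ℕ.< n → x ≢ y →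
                  ∃[ p ] HasEdge (translateZn n (C (proj₁ p)) (toℕ (proj₂ p))) x y
    edge-exists {x} {y} x<n y<n x≢y with balanced-residue (+ y - + x)
    ... | d , ∣d∣≤M , y-x≡d with D-partition ∣ d ∣ (difference-nonzero x<n y<n x≢y y-x≡d) ∣d∣≤M
    ... | i , ∣d∣∈Dᵢ , _
      with orientedEdge-of-length {C i} (↭P.∈-resp-↭ (↭-sym (IsStarter.edgeLengths↭ (starter i))) ∣d∣∈Dᵢ)
    ... | u , v , edge , v-u≡d with translate-onto {C i} edge (≡mod-trans (≡mod-reflexive v-u≡d) (≡mod-sym y-x≡d)) x<n y<n
    ... | j , hasEdge = (i , j) , hasEdge

    edge-length∈D : ∀ i {u v} → OrientedEdge (C i) u v → ∣ v - u ∣ ∈ D i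
    edge-length∈D i edge = ↭P.∈-resp-↭ (IsStarter.edgeLengths↭ (starter i)) (orientedEdge-length∈ edge)

    edge-length-bounds : ∀ i {u v} → OrientedEdge (C i) u v → 1 ℕ.≤ ∣ v - u ∣ × ∣ v - u ∣ ℕ.≤ M
    edge-length-bounds i edge = D-bounded i _ (edge-length∈D i edge)

    displacement-≡mod : ∀ j j′ {u u′ v v′} → vertex j u ≡ vertex j′ u′ → vertex j v ≡ vertex j′ v′ →
                        v - u ≡ v′ - u′ ⟨mod n ⟩
    displacement-≡mod j j′ {u} {u′} {v} {v′} u↦ v↦ = begin
      v - u                           ≡⟨ cancel-j v u (+ j) ⟨
      (v + + j) - (u + + j)           ≈⟨ -‿cong-mod (vertex-≡⇒≡mod j v j′ v′ v↦) (vertex-≡⇒≡mod j u j′ u′ u↦) ⟩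
      (v′ + + j′) - (u′ + + j′)       ≡⟨ cancel-j v′ u′ (+ j′) ⟩
      v′ - u′                         ∎
      where
      open ≡mod-Reasoning
      cancel-j : ∀ v u j → (v + j) - (u + j) ≡ v - u
      cancel-j = solve-∀

    same-displacement : ∀ i i′ {j j′ u v u′ v′} → OrientedEdge (C i) u v → OrientedEdge (C i′) u′ v′ →
                        vertex j u ≡ vertex j′ u′ → vertex j v ≡ vertex j′ v′ → v - u ≡ v′ - u′
    same-displacement i i′ {j} {j′} {u} {v} {u′} {v′} edge edge′ u↦ v↦ =
      ≡mod∧small⇒≡ (displacement-≡mod j j′ {u} {u′} {v} {v′} u↦ v↦)
        (∣i-j∣<n (v - u) (v′ - u′) (proj₂ (edge-length-bounds i edge)) (proj₂ (edge-length-bounds i′ edge′)))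

    same-starter : ∀ {i i′ u v u′ v′} → OrientedEdge (C i) u v → OrientedEdge (C i′) u′ v′ →
                   v - u ≡ v′ - u′ → i ≡ i′
    same-starter {i} {i′} {u} {v} edge edge′ v-u≡v′-u′
      with D-partition ∣ v - u ∣ (proj₁ (edge-length-bounds i edge)) (proj₂ (edge-length-bounds i edge))
    ... | _ , _ , owner =
      trans (sym (owner (edge-length∈D i edge)))
            (owner (subst (_∈ D i′) (cong ∣_∣ (sym v-u≡v′-u′)) (edge-length∈D i′ edge′)))

    same-translate : ∀ i {j j′ u v u′ v′} → OrientedEdge (C i) u v → OrientedEdge (C i) u′ v′ →
                     vertex (toℕ j) u ≡ vertex (toℕ j′) u′ → vertex (toℕ j) v ≡ vertex (toℕ j′) v′ → j ≡ j′
    same-translate i {j} {j′} {u} {v} {u′} {v′} edge edge′ u↦ v↦ = FinP.toℕ-injective (+-injective-mod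
      (+-cancelˡ-mod u (vertex-≡⇒≡mod (toℕ j) u (toℕ j′) u
        (subst (λ w → vertex (toℕ j) u ≡ vertex (toℕ j′) w) (sym u≡u′) u↦)))
      (FinP.toℕ<n j) (FinP.toℕ<n j′))
      where
      v-u≡v′-u′ : v - u ≡ v′ - u′
      v-u≡v′-u′ = same-displacement i i edge edge′ u↦ v↦
      nonzero : v - u ≢ + 0
      nonzero v-u≡0 = contradiction (subst (λ z → 1 ℕ.≤ ∣ z ∣) v-u≡0 (proj₁ (edge-length-bounds i edge))) λ ()
      u≡u′ : u ≡ u′
      u≡u′ = proj₁ (orientedEdge-unique (IsStarter.edgeLengths-unique (starter i)) edge edge′ v-u≡v′-u′ nonzero)

    edge-unique : ∀ {x y} {p p′ : Fin m × Fin n} →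
                  HasEdge (translateZn n (C (proj₁ p)) (toℕ (proj₂ p))) x y →
                  HasEdge (translateZn n (C (proj₁ p′)) (toℕ (proj₂ p′))) x y → p ≡ p′
    edge-unique {p = i , j} {i′ , j′} h h′
      with hasEdge-map⁻ {f = vertex (toℕ j)} {C i} h | hasEdge-map⁻ {f = vertex (toℕ j′)} {C i′} h′
    ... | u , v , edge , u↦x , v↦y | u′ , v′ , edge′ , u′↦x , v′↦y =
      cong₂ _,_ i≡i′ (same-translate i edge (subst (λ k → OrientedEdge (C k) u′ v′) (sym i≡i′) edge′) u↦u′ v↦v′)
      where
      u↦u′ : vertex (toℕ j) u ≡ vertex (toℕ j′) u′
      u↦u′ = trans u↦x (sym u′↦x)
      v↦v′ : vertex (toℕ j) v ≡ vertex (toℕ j′) v′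
      v↦v′ = trans v↦y (sym v′↦y)
      i≡i′ : i ≡ i′
      i≡i′ = same-starter edge edge′ (same-displacement i i′ edge edge′ u↦u′ v↦v′)

    edge-partition : ∀ {x y} → x ℕ.< n → y ℕ.< n → x ≢ y →
                     ∃! _≡_ (λ (p : Fin m × Fin n) → HasEdge (translateZn n (C (proj₁ p)) (toℕ (proj₂ p))) x y)
    edge-partition x<n y<n x≢y = let (p , h) = edge-exists x<n y<n x≢y in p , h , edge-unique h

    length-translate : ∀ i j → length (translateZn n (C i) j) ≡ length (D i)
    length-translate i j = begin
      length (translateZn n (C i) j) ≡⟨ LP.length-map _ (C i) ⟩
      length (C i)                   ≡⟨ length-edgeLengths (C i) ⟨
      length (edgeLengths (C i))     ≡⟨ ↭P.↭-length (IsStarter.edgeLengths↭ (starter i)) ⟩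
      length (D i)                   ∎
      where open ≡-Reasoning

open import Data.Nat using (_+_; _*_; _≤_; _<_)

corollary8 : (k n m : ℕ) → 2 ≤ k → n ≡ 1 + m * (4 * k) →
    (D : Fin m → List ℕ) → (τ : Fin m → ℕ) →
    (∀ i → StrictlyIncreasing (D i)) →
    (∀ i → length (D i) ≡ 2 * k) →
    (∀ i → BalancedWith (τ i) (D i)) →
    (∀ i x → x ∈ D i → 1 ≤ x × x ≤ (n ∸ 1) / 2) →
    (∀ x → 1 ≤ x → x ≤ (n ∸ 1) / 2 → ∃! _≡_ (λ i → x ∈ D i)) →
    (∀ (i : Fin m) (j : Fin n) → IsCycleIn n (2 * k) (translateZn n (cycleC (τ i) (D i)) (toℕ j)))
    × (∀ x y → x < n → y < n → x ≢ y →
         ∃! _≡_ (λ (p : Fin m × Fin n) →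
           HasEdge (translateZn n (cycleC (τ (proj₁ p)) (D (proj₁ p)))
                                  (toℕ (proj₂ p))) x y))
    × (∀ (i : Fin m) (j : Fin n) (g : ℕ) → ∃ λ (j′ : Fin n) →
         shiftZn n g (translateZn n (cycleC (τ i) (D i)) (toℕ j))
           ≡ translateZn n (cycleC (τ i) (D i)) (toℕ j′))
corollary8 k _ m _ refl D τ increasing length≡ balanced bounded partition =
  (λ i j → trans (length-translate i (toℕ j)) (length≡ i) , translate-unique i (toℕ j) , translate-bounded (C i) (toℕ j)) ,
  (λ x y → edge-partition) ,
  (λ i → translate-closed (C i))
  where
  N M : ℕ
  N = m * (4 * k)
  M = N / 2
  half : M ≡ m * (2 * k)
  half = trans (cong (_/ 2) (quadruple m k)) (m*n/n≡m (m * (2 * k)) 2)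
    where quadruple : ∀ m k → m * (4 * k) ≡ m * (2 * k) * 2
          quadruple = solveℕ-∀
  M+M≡N : M + M ≡ N
  M+M≡N = trans (cong₂ _+_ half half) (double m k)
    where double : ∀ m k → m * (2 * k) + m * (2 * k) ≡ m * (4 * k)
          double = solveℕ-∀
  C : Fin m → List ℤ
  C i = cycleC (τ i) (D i)
  open Decomposition M N M+M≡N D C (λ i → starter k (τ i) (D i) (increasing i) (length≡ i) (balanced i) (bounded i))
    bounded partition
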